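{- Let $n\ge 3$. If $n$ is even, then $$p_{n+1,i}=\begin{cases}p_{n,i} & \text{if } i=-1,\\ p_{n,i-1}+p_{n,i} & \text{if } i=0,1,\dots,\frac n2-2,\\ p_{n,i-1} & \text{if } i=\frac n2-1;\end{cases}$$ if $n$ is odd, then $$p_{n+1,i}=\begin{cases}p_{n,i} & \text{if } i=-1,\\ p_{n,i-1}+p_{n,i} & \text{if } i=0,1,\dots,\frac{n-3}{2}.\end{cases}$$ Moreover $(p_{3,-1},p_{3,0})=(1,1)$.
   Context: $[n]=\{1,\dots,n\}$; $\mathfrak S_n$ is the set of permutations of $[n]$ in one-line notation. The circular peak set of $\sigma\in\mathfrak S_n$ is $CP(\sigma)=\{\sigma(i)\mid 2\le i\le n-1,\ \sigma(i-1)<\sigma(i)>\sigma(i+1)\}$; for $S\subseteq[n]$, $CP_n(S)=\{\sigma\in\mathfrak S_n\mid CP(\sigma)=S\}$, and $\mathcal P_n=\{S\subseteq[n]\mid CP_n(S)\neq\emptyset\}$. For $i\ge -1$, $p_{n,i}$ is the number of $S\in\mathcal P_n$ with $|S|=i+1$. -}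

module Defs where

open import Data.Nat using (ℕ; zero; suc)
open import Data.Bool using (Bool; true; false; if_then_else_; _∧_)
open import Data.Fin using (Fin; _<?_) renaming (_≟_ to _≟ᶠ_)
open import Data.Fin.Subset using (Subset; inside; outside; ∣_∣)
open import Data.List using (List; []; _∷_; [_]; map; concatMap; filter; length; allFin)
open import Data.Vec using (Vec; []; _∷_; toList; tabulate)
open import Data.Vec.Properties using (≡-dec)
open import Data.Bool.Properties using () renaming (_≟_ to _≟ᵇ_)
open import Data.List.Relation.Unary.Any using (any?)
open import Relation.Nullary using (Dec; ⌊_⌋; _×-dec_)
open import Relation.Binary.PropositionalEquality using (_≡_)
import Data.List.Membership.DecPropositional as Mem
import Data.List.Relation.Unary.Unique.DecPropositional as Uniq
open import Data.Nat using () renaming (_≟_ to _≟ⁿ_)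

-- Convention: [n] = {1,…,n} is represented by Fin n = {0,…,n-1}
-- (order-preserving relabelling v ↦ v+1).

vecsOver : {A : Set} → List A → (m : ℕ) → List (Vec A m)
vecsOver xs zero    = [ [] ]
vecsOver xs (suc m) = concatMap (λ x → map (x ∷_) (vecsOver xs m)) xs

perms : (n : ℕ) → List (Vec (Fin n) n)
perms n = filter (λ σ → Uniq.unique? _≟ᶠ_ (toList σ)) (vecsOver (allFin n) n)

subsets : (n : ℕ) → List (Subset n)
subsets n = vecsOver (inside ∷ outside ∷ []) n

peaks : {n : ℕ} → List (Fin n) → List (Fin n)
peaks (a ∷ l@(b ∷ c ∷ xs)) =
  if ⌊ a <? b ⌋ ∧ ⌊ c <? b ⌋ then b ∷ peaks l else peaks l
peaks _ = []

CP : {n : ℕ} → Vec (Fin n) n → Subset n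
CP σ = tabulate (λ v → if ⌊ Mem._∈?_ _≟ᶠ_ v (peaks (toList σ)) ⌋ then inside else outside)

inP? : (n : ℕ) → (S : Subset n) → Dec _
inP? n S = any? (λ σ → ≡-dec _≟ᵇ_ (CP σ) S) (perms n)

-- pp n j = p_{n, j-1} = #{ S ∈ 𝒫_n : |S| = j }   (index shifted: j = i+1 ≥ 0).
pp : ℕ → ℕ → ℕ
pp n j = length (filter (λ S → (∣ S ∣ ≟ⁿ j) ×-dec inP? n S) (subsets n))

module Submission where

-- Reading the values 1, 2, … upwards, S ⊆ [n] is a peak set iff every s ∈ S has at least two
-- more non-elements than elements of S below it.  Necessity: both neighbours of a peak p ≤ v are
-- non-peaks below v, and the left neighbours of these peaks together with the right neighbour of
-- the rightmost one are distinct, so there are more non-peak values below v than peak values up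
-- to v.  Sufficiency: in the arrangement t₁ s₁ t₂ s₂ … of the non-elements t₁ < t₂ < … and the
-- elements s₁ < s₂ < …, the peaks are exactly the sᵢ, since tᵢ, tᵢ₊₁ < sᵢ.
-- The condition is decided by a credit counter whose final value on S ⊆ [m] is m − 2|S|.  A new
-- largest value can always be added outside S, and inside S exactly when that credit is at least
-- 2; so the number a(m, k) of peak sets of size k satisfies
-- a(m + 1, k + 1) = [2(k + 1) ≤ m] a(m, k) + a(m, k + 1), and a(m, k + 1) = 0 once m ≤ 2(k + 1).

open import Defs
open import Data.Bool using (Bool; true; false; T; _∧_; not; if_then_else_)
open import Data.Bool.Properties using (∧-zeroʳ; ∧-identityʳ; T-∧; T-≡)
open import Data.Empty using (⊥)
open import Data.Fin using (Fin; zero; suc; _<?_) renaming (_<_ to _<ᶠ_; _≤_ to _≤ᶠ_; _≟_ to _≟ᶠ_)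
open import Data.Fin.Properties as Fin using (_≤?_)
open import Data.Fin.Subset using (Subset; inside; outside; ∁; ∣_∣) renaming (_∈_ to _∈ₛ_)
open import Data.List using (List; []; _∷_; _++_; map; head; length; filter; filterᵇ; allFin)
open import Data.List.Membership.Propositional using (_∈_; lose; find)
open import Data.List.Membership.Propositional.Properties
  using (∈-∃++; ∈-++⁻; ∈-++⁺ˡ; ∈-++⁺ʳ; ∈-map⁺; ∈-map⁻; ∈-filter⁺; ∈-filter⁻; ∈-allFin; ∈-concatMap⁺)
open import Data.List.Relation.Binary.Permutation.Propositional using (_↭_; ↭-refl; ↭-prep; ↭-trans; ↭-sym; ↭⇒↭ₛ)
open import Data.List.Relation.Binary.Permutation.Propositional.Properties using (++-comm; shift; ↭-length)
open import Data.List.Relation.Binary.Permutation.Setoid.Properties using (Unique-resp-↭)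
open import Data.List.Relation.Unary.All as All using (All; []; _∷_)
open import Data.List.Relation.Unary.AllPairs as AllPairs using (AllPairs; []; _∷_)
open import Data.List.Relation.Unary.Any using (Any; here; there)
open import Data.List.Relation.Unary.Unique.Propositional using (Unique)
import Data.List.Membership.DecPropositional as DecMembership
import Data.List.Properties as List
import Data.List.Relation.Unary.AllPairs.Properties as AllPairs
import Data.List.Relation.Unary.Unique.DecPropositional as DecUnique
import Data.List.Relation.Unary.Unique.Propositional.Properties as Unique
open import Data.Maybe using (Maybe; just; nothing; is-just; _>>=_)
open import Data.Nat using (ℕ; zero; suc; _+_; _*_; _∸_; _≤_; _<_; z≤n; s≤s; _/_; _%_)
open import Data.Nat.DivMod using (m≡m%n+[m/n]*n; m/n*n≤m)
import Data.Nat.Properties as ℕ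
open import Algebra.Properties.CommutativeSemigroup ℕ.+-commutativeSemigroup using (interchange)
open import Data.Product using (Σ; _×_; _,_; proj₁; proj₂)
open import Data.Sum using (inj₁; inj₂)
open import Data.Unit using (⊤; tt)
open import Data.Vec using (Vec; []; _∷_; _∷ʳ_; here; there; toList; fromList; lookup; tabulate)
open import Data.Vec.Properties using (toList∘fromList; lookup∘tabulate; tabulate∘lookup; tabulate-cong; lookup-map; lookup⇒[]=; []=⇒lookup)
open import Function using (_∘_; id; _⇔_; mk⇔; Equivalence)
open import Relation.Nullary using (Dec; does; yes; no; ⌊_⌋; ¬_; contradiction; _×-dec_)
open import Relation.Nullary.Decidable using (dec-true; dec-false; does-⇔; isYes≗does; T?; toWitness; fromWitness; fromWitnessFalse)
open import Relation.Binary.PropositionalEquality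

private variable
  A B : Set
  m n : ℕ

count : (A → Bool) → List A → ℕ
count p []       = 0
count p (x ∷ xs) = if p x then suc (count p xs) else count p xs

count-cong : {p q : A → Bool} → (∀ x → p x ≡ q x) → (xs : List A) → count p xs ≡ count q xs
count-cong p≗q [] = refl
count-cong {q = q} p≗q (x ∷ xs) rewrite p≗q x with q x
... | true  = cong suc (count-cong p≗q xs)
... | false = count-cong p≗q xs

count-++ : (p : A → Bool) (xs ys : List A) → count p (xs ++ ys) ≡ count p xs + count p ys
count-++ p [] ys = refl
count-++ p (x ∷ xs) ys with p x
... | true  = cong suc (count-++ p xs ys)
... | false = count-++ p xs ys

count-map : (p : B → Bool) (f : A → B) (xs : List A) → count p (map f xs) ≡ count (p ∘ f) xs
count-map p f [] = refl
count-map p f (x ∷ xs) with p (f x)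
... | true  = cong suc (count-map p f xs)
... | false = count-map p f xs

count-filterᵇ : (p q : A → Bool) (xs : List A) → count p (filterᵇ q xs) ≡ count (λ x → q x ∧ p x) xs
count-filterᵇ p q [] = refl
count-filterᵇ p q (x ∷ xs) with q x
... | false = count-filterᵇ p q xs
... | true with p x
...   | true  = cong suc (count-filterᵇ p q xs)
...   | false = count-filterᵇ p q xs

count-none : {p : A → Bool} {xs : List A} → All (λ x → p x ≡ false) xs → count p xs ≡ 0
count-none [] = refl
count-none (px≡false ∷ pxs) rewrite px≡false = count-none pxs

count-false : (xs : List A) → count (λ _ → false) xs ≡ 0
count-false []       = refl
count-false (_ ∷ xs) = count-false xs

count-∧-const : (p : A → Bool) (b : Bool) (xs : List A) → count (λ x → p x ∧ b) xs ≡ (if b then count p xs else 0)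
count-∧-const p true  xs = count-cong (λ x → ∧-identityʳ (p x)) xs
count-∧-const p false xs = trans (count-cong (λ x → ∧-zeroʳ (p x)) xs) (count-false xs)

count-∷-true : {p : A → Bool} {x : A} (xs : List A) → p x ≡ true → count p (x ∷ xs) ≡ suc (count p xs)
count-∷-true xs px≡true rewrite px≡true = refl

count-∷-≤ : (p : A → Bool) (x : A) (xs : List A) → count p (x ∷ xs) ≤ suc (count p xs)
count-∷-≤ p x xs with p x
... | true  = ℕ.≤-refl
... | false = ℕ.n≤1+n _

count-∷-≥ : (p : A → Bool) (x : A) (xs : List A) → count p xs ≤ count p (x ∷ xs)
count-∷-≥ p x xs with p x
... | true  = ℕ.n≤1+n _
... | false = ℕ.≤-refl

length-filter≡count : {P : A → Set} (P? : ∀ x → Dec (P x)) (p : A → Bool) → (∀ x → does (P? x) ≡ p x) →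
                      (xs : List A) → length (filter P? xs) ≡ count p xs
length-filter≡count P? p P?≗p [] = refl
length-filter≡count P? p P?≗p (x ∷ xs) with does (P? x) | p x | P?≗p x
... | true  | .true  | refl = cong suc (length-filter≡count P? p P?≗p xs)
... | false | .false | refl = length-filter≡count P? p P?≗p xs

length-filterᵇ : (p : A → Bool) (xs : List A) → length (filterᵇ p xs) ≡ count p xs
length-filterᵇ p = length-filter≡count (T? ∘ p) p (λ _ → refl)

Unique⇒length≤ : {xs ys : List A} → Unique xs → (∀ {x} → x ∈ xs → x ∈ ys) → length xs ≤ length ys
Unique⇒length≤ {xs = []} _ _ = z≤n
Unique⇒length≤ {xs = x ∷ xs} (x∉xs ∷ unique) xs⊆ys with ∈-∃++ (xs⊆ys (here refl))
... | as , bs , refl = subst (suc (length xs) ≤_) (sym (List.length-++-sucʳ as x bs)) (s≤s (Unique⇒length≤ unique xs⊆as++bs))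
  where
  xs⊆as++bs : ∀ {z} → z ∈ xs → z ∈ as ++ bs
  xs⊆as++bs z∈xs with ∈-++⁻ as (xs⊆ys (there z∈xs))
  ... | inj₁ z∈as         = ∈-++⁺ˡ z∈as
  ... | inj₂ (here refl)  = contradiction refl (All.lookup x∉xs z∈xs)
  ... | inj₂ (there z∈bs) = ∈-++⁺ʳ as z∈bs

Unique-map-injective : {f : A → B} {xs : List A} → Unique (map f xs) →
                       ∀ {x y} → x ∈ xs → y ∈ xs → f x ≡ f y → x ≡ y
Unique-map-injective {xs = _ ∷ _} _ (here refl) (here refl) _ = refl
Unique-map-injective {f = f} {_ ∷ _} (fx∉ ∷ _) (here refl) (there y∈) fx≡fy =
  contradiction fx≡fy (All.lookup fx∉ (∈-map⁺ f y∈))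
Unique-map-injective {f = f} {_ ∷ _} (fy∉ ∷ _) (there x∈) (here refl) fx≡fy =
  contradiction (sym fx≡fy) (All.lookup fy∉ (∈-map⁺ f x∈))
Unique-map-injective {xs = _ ∷ _} (_ ∷ unique) (there x∈) (there y∈) fx≡fy = Unique-map-injective unique x∈ y∈ fx≡fy

∈-vecsOver : ∀ {m} {xs : List A} → (∀ x → x ∈ xs) → (w : Vec A m) → w ∈ vecsOver xs m
∈-vecsOver all [] = here refl
∈-vecsOver {m = suc m} {xs = xs} all (x ∷ w) =
  ∈-concatMap⁺ (λ y → map (y ∷_) (vecsOver xs m)) (lose (all x) (∈-map⁺ (x ∷_) (∈-vecsOver all w)))

fromList-≡ : (xs : List A) → length xs ≡ m → Σ (Vec A m) λ w → toList w ≡ xs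
fromList-≡ xs refl = fromList xs , toList∘fromList xs

alternate : List A → List A → List A
alternate []       ys = ys
alternate (x ∷ xs) ys = x ∷ alternate ys xs

alternate-[] : (xs : List A) → alternate xs [] ≡ xs
alternate-[] []       = refl
alternate-[] (x ∷ xs) = refl

alternate-↭ : (xs ys : List A) → alternate xs ys ↭ xs ++ ys
alternate-↭ []       ys = ↭-refl
alternate-↭ (x ∷ xs) ys = ↭-prep x (↭-trans (alternate-↭ ys xs) (++-comm ys xs))

filterᵇ-partition-↭ : (p : A → Bool) (xs : List A) → filterᵇ (not ∘ p) xs ++ filterᵇ p xs ↭ xs
filterᵇ-partition-↭ p [] = ↭-refl
filterᵇ-partition-↭ p (x ∷ xs) with p x
... | true  = ↭-trans (shift x (filterᵇ (not ∘ p) xs) (filterᵇ p xs)) (↭-prep x (filterᵇ-partition-↭ p xs))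
... | false = ↭-prep x (filterᵇ-partition-↭ p xs)

∈-filterᵇ-allFin : {p : Fin n → Bool} {v : Fin n} → (v ∈ filterᵇ p (allFin n)) ⇔ T (p v)
∈-filterᵇ-allFin {n} {p} {v} = mk⇔ (proj₂ ∘ ∈-filter⁻ (T? ∘ p) {xs = allFin n}) (∈-filter⁺ (T? ∘ p) (∈-allFin v))

-- The credit automaton

-- Before value v is read, the credit is c + |{u < v | u ∉ S}| − |{u < v | u ∈ S}|;
-- an element of S needs credit at least 2.
consume : Bool → ℕ → Maybe ℕ
consume outside c             = just (suc c)
consume inside  (suc (suc c)) = just (suc c)
consume inside  _             = nothing

finalCredit : ℕ → Subset m → Maybe ℕ
finalCredit c []      = just c
finalCredit c (x ∷ S) = consume x c >>= λ c′ → finalCredit c′ S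

admissible : ℕ → Subset m → Bool
admissible c S = is-just (finalCredit c S)

finalCredit-∷ʳ : (c : ℕ) (S : Subset m) (x : Bool) → finalCredit c (S ∷ʳ x) ≡ (finalCredit c S >>= consume x)
finalCredit-∷ʳ c [] x with consume x c
... | just _  = refl
... | nothing = refl
finalCredit-∷ʳ c (y ∷ S) x with consume y c
... | just c′ = finalCredit-∷ʳ c′ S x
... | nothing = refl

finalCredit-invariant : ∀ c (S : Subset m) {c′} → finalCredit c S ≡ just c′ → c′ + 2 * ∣ S ∣ ≡ c + m
finalCredit-invariant c [] refl = refl
finalCredit-invariant c (outside ∷ S) eq = trans (finalCredit-invariant (suc c) S eq) (sym (ℕ.+-suc c _))
finalCredit-invariant {suc m} (suc (suc c)) (inside ∷ S) {c′} eq = begin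
  c′ + 2 * suc ∣ S ∣           ≡⟨ cong (c′ +_) (ℕ.*-suc 2 ∣ S ∣) ⟩
  c′ + suc (suc (2 * ∣ S ∣))   ≡⟨ ℕ.+-suc c′ _ ⟩
  suc (c′ + suc (2 * ∣ S ∣))   ≡⟨ cong suc (ℕ.+-suc c′ _) ⟩
  suc (suc (c′ + 2 * ∣ S ∣))   ≡⟨ cong (2 +_) (finalCredit-invariant (suc c) S eq) ⟩
  suc (suc (suc (c + m)))      ≡⟨ cong (2 +_) (sym (ℕ.+-suc c m)) ⟩
  suc (suc c) + suc m          ∎
  where open ≡-Reasoning

admissible-∷ʳ-outside : ∀ c (S : Subset m) → admissible c (S ∷ʳ outside) ≡ admissible c S
admissible-∷ʳ-outside c S rewrite finalCredit-∷ʳ c S outside with finalCredit c S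
... | just _  = refl
... | nothing = refl

is-just-consume-inside : ∀ c → is-just (consume inside c) ≡ does (2 ℕ.≤? c)
is-just-consume-inside 0             = refl
is-just-consume-inside 1             = refl
is-just-consume-inside (suc (suc c)) = refl

admissible-∷ʳ-inside : ∀ c (S : Subset m) →
  admissible c (S ∷ʳ inside) ≡ admissible c S ∧ does (2 * suc ∣ S ∣ ℕ.≤? c + m)
admissible-∷ʳ-inside {m} c S rewrite finalCredit-∷ʳ c S inside with finalCredit c S in eq
... | nothing = refl
... | just c′ = begin
  is-just (consume inside c′)               ≡⟨ is-just-consume-inside c′ ⟩
  does (2 ℕ.≤? c′)                           ≡⟨ does-⇔ (mk⇔ (ℕ.+-monoˡ-≤ (2 * ∣ S ∣)) (ℕ.+-cancelʳ-≤ (2 * ∣ S ∣) 2 c′))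
                                                       (2 ℕ.≤? c′) (2 + 2 * ∣ S ∣ ℕ.≤? c′ + 2 * ∣ S ∣) ⟩
  does (2 + 2 * ∣ S ∣ ℕ.≤? c′ + 2 * ∣ S ∣)    ≡⟨ cong₂ (λ a b → does (a ℕ.≤? b)) (sym (ℕ.*-suc 2 ∣ S ∣)) (finalCredit-invariant c S eq) ⟩
  does (2 * suc ∣ S ∣ ℕ.≤? c + m)             ∎
  where open ≡-Reasoning

-- Admissible subsets are the balanced ones

below : Subset m → Fin m → ℕ
below {m} S v = count (λ u → lookup S u ∧ does (u <? v)) (allFin m)

Balanced : ℕ → Subset m → Set
Balanced c S = ∀ {v} → v ∈ₛ S → below S v + 2 ≤ c + below (∁ S) v

count-allFin-suc : (p : Fin (suc m) → Bool) →
  count p (allFin (suc m)) ≡ (if p zero then suc else id) (count (p ∘ suc) (allFin m))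
count-allFin-suc {m} p with p zero
... | true  = cong suc count-tail
  where count-tail = trans (cong (count p) (sym (List.map-tabulate id suc))) (count-map p suc (allFin m))
... | false = trans (cong (count p) (sym (List.map-tabulate id suc))) (count-map p suc (allFin m))

below-zero : (S : Subset (suc m)) → below S zero ≡ 0
below-zero {m} S = trans (count-cong (λ u → ∧-zeroʳ (lookup S u)) (allFin (suc m))) (count-false (allFin (suc m)))

below-suc : (x : Bool) (S : Subset m) (v : Fin m) → below (x ∷ S) (suc v) ≡ (if x then suc else id) (below S v)
below-suc true  S v = count-allFin-suc (λ u → lookup (true ∷ S) u ∧ does (u <? suc v))
below-suc false S v = count-allFin-suc (λ u → lookup (false ∷ S) u ∧ does (u <? suc v))

balance-zero : ∀ c (S : Subset (suc m)) → (below S zero + 2 ≤ c + below (∁ S) zero) ≡ (2 ≤ c + 0)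
balance-zero c S = cong₂ (λ a b → a + 2 ≤ c + b) (below-zero S) (below-zero (∁ S))

balance-suc : ∀ c x (S : Subset m) v →
  (below (x ∷ S) (suc v) + 2 ≤ c + below (∁ (x ∷ S)) (suc v)) ≡
  ((if x then suc else id) (below S v) + 2 ≤ c + (if not x then suc else id) (below (∁ S) v))
balance-suc c x S v = cong₂ (λ a b → a + 2 ≤ c + b) (below-suc x S v) (below-suc (not x) (∁ S) v)

balanced-outside⁻ : ∀ {c} (S : Subset m) → Balanced c (outside ∷ S) → Balanced (suc c) S
balanced-outside⁻ {c = c} S bal {v} v∈S =
  subst (below S v + 2 ≤_) (ℕ.+-suc c _) (subst id (balance-suc c outside S v) (bal (there v∈S)))

balanced-outside⁺ : ∀ {c} (S : Subset m) → Balanced (suc c) S → Balanced c (outside ∷ S)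
balanced-outside⁺ {c = c} S bal (there {i = v} v∈S) =
  subst id (sym (balance-suc c outside S v)) (subst (below S v + 2 ≤_) (sym (ℕ.+-suc c _)) (bal v∈S))

balanced-inside⁻ : ∀ {c} (S : Subset m) → Balanced (suc (suc c)) (inside ∷ S) → Balanced (suc c) S
balanced-inside⁻ {c = c} S bal {v} v∈S = ℕ.≤-pred (subst id (balance-suc (suc (suc c)) inside S v) (bal (there v∈S)))

balanced-inside⁺ : ∀ {c} (S : Subset m) → Balanced (suc c) S → Balanced (suc (suc c)) (inside ∷ S)
balanced-inside⁺ {c = c} S bal here = subst id (sym (balance-zero (suc (suc c)) (inside ∷ S))) (s≤s (s≤s z≤n))
balanced-inside⁺ {c = c} S bal (there {i = v} v∈S) = subst id (sym (balance-suc (suc (suc c)) inside S v)) (s≤s (bal v∈S))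

balanced-inside-credit : ∀ {c} (S : Subset m) → Balanced c (inside ∷ S) → 2 ≤ c
balanced-inside-credit {c = c} S bal = subst (2 ≤_) (ℕ.+-identityʳ c) (subst id (balance-zero c (inside ∷ S)) (bal here))

admissible⇒balanced : ∀ c (S : Subset m) → T (admissible c S) → Balanced c S
admissible⇒balanced c [] _ ()
admissible⇒balanced c (outside ∷ S) adm = balanced-outside⁺ S (admissible⇒balanced (suc c) S adm)
admissible⇒balanced (suc (suc c)) (inside ∷ S) adm = balanced-inside⁺ S (admissible⇒balanced (suc c) S adm)

balanced⇒admissible : ∀ c (S : Subset m) → Balanced c S → T (admissible c S)
balanced⇒admissible c [] _ = tt
balanced⇒admissible c (outside ∷ S) bal = balanced⇒admissible (suc c) S (balanced-outside⁻ S bal)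
balanced⇒admissible (suc (suc c)) (inside ∷ S) bal = balanced⇒admissible (suc c) S (balanced-inside⁻ S bal)
balanced⇒admissible zero (inside ∷ S) bal with () ← balanced-inside-credit S bal
balanced⇒admissible (suc zero) (inside ∷ S) bal with s≤s () ← balanced-inside-credit S bal

-- Balanced subsets are peak sets

Increasing : List (Fin n) → Set
Increasing = AllPairs _<ᶠ_

peaks-peak : ∀ {a b c : Fin n} xs → a <ᶠ b → c <ᶠ b → peaks (a ∷ b ∷ c ∷ xs) ≡ b ∷ peaks (b ∷ c ∷ xs)
peaks-peak {a = a} {b} {c} xs a<b c<b with a <? b | c <? b
... | yes _  | yes _  = refl
... | no a≮b | _      = contradiction a<b a≮b
... | yes _  | no c≮b = contradiction c<b c≮b

peaks-descent : ∀ {a b : Fin n} xs → ¬ a <ᶠ b → peaks (a ∷ b ∷ xs) ≡ peaks (b ∷ xs)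
peaks-descent [] _ = refl
peaks-descent {a = a} {b} (c ∷ xs) a≮b with a <? b
... | yes a<b = contradiction a<b a≮b
... | no _    = refl

peaks-ascent : ∀ {a b c : Fin n} xs → b <ᶠ c → peaks (a ∷ b ∷ c ∷ xs) ≡ peaks (b ∷ c ∷ xs)
peaks-ascent {a = a} {b} {c} xs b<c with a <? b | c <? b
... | yes _ | yes c<b = contradiction b<c (Fin.<-asym c<b)
... | yes _ | no _    = refl
... | no _  | _       = refl

peaks-increasing : (xs : List (Fin n)) → Increasing xs → peaks xs ≡ []
peaks-increasing []           _ = refl
peaks-increasing (a ∷ [])     _ = refl
peaks-increasing (a ∷ b ∷ []) _ = refl
peaks-increasing (a ∷ b ∷ c ∷ xs) (_ ∷ increasing@((b<c ∷ _) ∷ _)) =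
  trans (peaks-ascent xs b<c) (peaks-increasing (b ∷ c ∷ xs) increasing)

PeaksBetween : List (Fin n) → List (Fin n) → Set
PeaksBetween ts            []       = ⊤
PeaksBetween (t ∷ t′ ∷ ts) (s ∷ ss) = t <ᶠ s × t′ <ᶠ s × PeaksBetween (t′ ∷ ts) ss
PeaksBetween _             (_ ∷ _)  = ⊥

peaks-alternate : (ts ss : List (Fin n)) → Increasing ts → PeaksBetween ts ss → peaks (alternate ts ss) ≡ ss
peaks-alternate ts [] increasing _ = trans (cong peaks (alternate-[] ts)) (peaks-increasing ts increasing)
peaks-alternate (t ∷ t′ ∷ ts) (s ∷ ss) (_ ∷ increasing) (t<s , t′<s , between) = begin
  peaks (t ∷ s ∷ t′ ∷ alternate ss ts)   ≡⟨ peaks-peak (alternate ss ts) t<s t′<s ⟩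
  s ∷ peaks (s ∷ t′ ∷ alternate ss ts)   ≡⟨ cong (s ∷_) (peaks-descent (alternate ss ts) (Fin.<-asym t′<s)) ⟩
  s ∷ peaks (alternate (t′ ∷ ts) ss)     ≡⟨ cong (s ∷_) (peaks-alternate (t′ ∷ ts) ss increasing between) ⟩
  s ∷ ss                                 ∎
  where open ≡-Reasoning

countBelow : Fin n → List (Fin n) → ℕ
countBelow s = count (λ u → does (u <? s))

countBelow-increasing : ∀ {s t : Fin n} {ts} → Increasing (t ∷ ts) → ¬ t <ᶠ s → countBelow s (t ∷ ts) ≡ 0
countBelow-increasing {s = s} {t} (t<ts ∷ _) t≮s =
  count-none (dec-false (t <? s) t≮s ∷ All.map (λ {x} t<x → dec-false (x <? s) (t≮s ∘ Fin.<-trans t<x)) t<ts)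

EnoughBelow : List (Fin n) → List (Fin n) → Set
EnoughBelow ts ss = ∀ {s} → s ∈ ss → countBelow s ss + 2 ≤ countBelow s ts

enoughBelow-head : ∀ {s : Fin n} {ss ts} → Increasing (s ∷ ss) → EnoughBelow ts (s ∷ ss) → 2 ≤ countBelow s ts
enoughBelow-head {s = s} {ss} {ts} increasing enough =
  subst (λ k → k + 2 ≤ countBelow s ts) (countBelow-increasing {ts = ss} increasing (Fin.<-irrefl refl)) (enough (here refl))

enoughBelow⇒peaksBetween : (ts ss : List (Fin n)) → Increasing ts → Increasing ss → EnoughBelow ts ss → PeaksBetween ts ss
enoughBelow⇒peaksBetween ts [] _ _ _ = tt
enoughBelow⇒peaksBetween [] (s ∷ ss) _ increasing-ss enough =
  contradiction (enoughBelow-head {ts = []} increasing-ss enough) λ ()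
enoughBelow⇒peaksBetween (t ∷ []) (s ∷ ss) _ increasing-ss enough =
  contradiction (ℕ.≤-trans (enoughBelow-head {ts = t ∷ []} increasing-ss enough) (count-∷-≤ (λ u → does (u <? s)) t [])) λ { (s≤s ()) }
enoughBelow⇒peaksBetween (t ∷ t′ ∷ ts) (s ∷ ss) ((t<t′ ∷ _) ∷ increasing) increasing-ss enough with t′ <? s
... | no t′≮s = contradiction (ℕ.≤-trans (enoughBelow-head {ts = t ∷ t′ ∷ ts} increasing-ss enough) (count-∷-≤ (λ u → does (u <? s)) t (t′ ∷ ts)))
                  (λ { (s≤s le) → ℕ.<⇒≱ (s≤s z≤n) (ℕ.≤-trans le (ℕ.≤-reflexive (countBelow-increasing {ts = ts} increasing t′≮s))) })
... | yes t′<s = t<s , t′<s , enoughBelow⇒peaksBetween (t′ ∷ ts) ss increasing (AllPairs.tail increasing-ss) enough′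
  where
  t<s = Fin.<-trans t<t′ t′<s
  enough′ : EnoughBelow (t′ ∷ ts) ss
  enough′ {x} x∈ss = ℕ.≤-pred (subst₂ (λ a b → a + 2 ≤ b)
      (count-∷-true ss (dec-true (s <? x) s<x)) (count-∷-true (t′ ∷ ts) (dec-true (t <? x) (Fin.<-trans t<s s<x)))
      (enough (there x∈ss)))
    where
    s<x : s <ᶠ x
    s<x = All.lookup (AllPairs.head increasing-ss) x∈ss

_∈?_ : (v : Fin n) (xs : List (Fin n)) → Dec (v ∈ xs)
_∈?_ = DecMembership._∈?_ _≟ᶠ_

lookup-CP : (σ : Vec (Fin n) n) (v : Fin n) → lookup (CP σ) v ≡ ⌊ v ∈? peaks (toList σ) ⌋
lookup-CP σ v = trans (lookup∘tabulate _ v) (if-inside-outside _)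
  where
  if-inside-outside : ∀ b → (if b then inside else outside) ≡ b
  if-inside-outside true  = refl
  if-inside-outside false = refl

CP-≡ : (σ : Vec (Fin n) n) (S : Subset n) → peaks (toList σ) ≡ filterᵇ (lookup S) (allFin n) → CP σ ≡ S
CP-≡ {n} σ S peaks≡ = begin
  CP σ                     ≡⟨ sym (tabulate∘lookup (CP σ)) ⟩
  tabulate (lookup (CP σ)) ≡⟨ tabulate-cong pointwise ⟩
  tabulate (lookup S)      ≡⟨ tabulate∘lookup S ⟩
  S                        ∎
  where
  open ≡-Reasoning
  pointwise : ∀ v → lookup (CP σ) v ≡ lookup S v
  pointwise v = begin
    lookup (CP σ) v                              ≡⟨ trans (lookup-CP σ v) (isYes≗does (v ∈? peaks (toList σ))) ⟩
    does (v ∈? peaks (toList σ))                  ≡⟨ cong (λ xs → does (v ∈? xs)) peaks≡ ⟩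
    does (v ∈? filterᵇ (lookup S) (allFin n))     ≡⟨ does-⇔ ∈-filterᵇ-allFin (v ∈? _) (T? (lookup S v)) ⟩
    lookup S v                                   ∎

increasing-filterᵇ-allFin : (p : Fin n → Bool) → Increasing (filterᵇ p (allFin n))
increasing-filterᵇ-allFin p = AllPairs.filter⁺ (T? ∘ p) (AllPairs.tabulate⁺-< id)

balanced⇒peakSet : (S : Subset n) → Balanced 0 S → Any (λ σ → CP σ ≡ S) (perms n)
balanced⇒peakSet {n} S balanced = lose σ∈perms (CP-≡ σ S (trans (cong peaks toList-σ) peaks-L))
  where
  ss ts L : List (Fin n)
  ss = filterᵇ (lookup S) (allFin n)
  ts = filterᵇ (not ∘ lookup S) (allFin n)
  L  = alternate ts ss

  enough : EnoughBelow ts ss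
  enough {s} s∈ss = subst₂ (λ a b → a + 2 ≤ b) (sym (count-filterᵇ _ (lookup S) (allFin n))) below-∁S≡
                      (balanced (lookup⇒[]= s S (Equivalence.to T-≡ (Equivalence.to ∈-filterᵇ-allFin s∈ss))))
    where
    below-∁S≡ : below (∁ S) s ≡ countBelow s ts
    below-∁S≡ = trans (count-cong (λ u → cong (_∧ does (u <? s)) (lookup-map u not S)) (allFin n))
                      (sym (count-filterᵇ _ (not ∘ lookup S) (allFin n)))

  peaks-L : peaks L ≡ ss
  peaks-L = peaks-alternate ts ss (increasing-filterᵇ-allFin _)
              (enoughBelow⇒peaksBetween ts ss (increasing-filterᵇ-allFin _) (increasing-filterᵇ-allFin _) enough)

  L↭allFin : L ↭ allFin n
  L↭allFin = ↭-trans (alternate-↭ ts ss) (filterᵇ-partition-↭ (lookup S) (allFin n))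

  σ,toList-σ = fromList-≡ L (trans (↭-length L↭allFin) (List.length-tabulate id))

  σ : Vec (Fin n) n
  σ = proj₁ σ,toList-σ

  toList-σ : toList σ ≡ L
  toList-σ = proj₂ σ,toList-σ

  σ∈perms : σ ∈ perms n
  σ∈perms = ∈-filter⁺ (λ σ → DecUnique.unique? _≟ᶠ_ (toList σ)) (∈-vecsOver ∈-allFin σ)
              (subst Unique (sym toList-σ) (Unique-resp-↭ (setoid (Fin n)) (↭⇒↭ₛ (↭-sym L↭allFin)) (Unique.allFin⁺ n)))

-- Peak sets are balanced

data Mark : Set where
  peak low other : Mark

isPeak isLow : Mark → Bool
isPeak peak = true
isPeak _    = false
isLow low = true
isLow _   = false

Flanked : Mark → List Mark → Set
Flanked x []      = ⊤
Flanked x (y ∷ w) = (y ≡ peak → x ≡ low × head w ≡ just low) × Flanked y w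

count-peak≤count-low : ∀ {x} w → Flanked x w → count isPeak w ≤ count isLow w
count-peak≤count-low [] _ = z≤n
count-peak≤count-low (peak ∷ w) (flank , _) with flank refl
count-peak≤count-low (peak ∷ low ∷ w) (_ , _ , flanked) | _ = s≤s (count-peak≤count-low w flanked)
count-peak≤count-low (low ∷ w) (_ , flanked) = ℕ.m≤n⇒m≤1+n (count-peak≤count-low w flanked)
count-peak≤count-low (other ∷ w) (_ , flanked) = count-peak≤count-low w flanked

count-peak<count-low : ∀ {x} w → Flanked x w → peak ∈ w → count isPeak w < count isLow (x ∷ w)
count-peak<count-low (peak ∷ w) (flank , flanked) _ with flank refl
count-peak<count-low (peak ∷ low ∷ w) (_ , _ , flanked) _ | refl , _ = s≤s (s≤s (count-peak≤count-low w flanked))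
count-peak<count-low {x} (low ∷ w) (_ , flanked) (there peak∈w) =
  ℕ.≤-trans (count-peak<count-low w flanked peak∈w) (count-∷-≥ isLow x (low ∷ w))
count-peak<count-low {x} (other ∷ w) (_ , flanked) (there peak∈w) =
  ℕ.≤-trans (count-peak<count-low w flanked peak∈w) (count-∷-≥ isLow x (other ∷ w))

peakFlag : Fin n → Fin n → List (Fin n) → Bool
peakFlag a b []      = false
peakFlag a b (c ∷ _) = ⌊ a <? b ⌋ ∧ ⌊ c <? b ⌋

flagPeaksAfter : Fin n → List (Fin n) → List (Fin n × Bool)
flagPeaksAfter a []       = []
flagPeaksAfter a (b ∷ xs) = (b , peakFlag a b xs) ∷ flagPeaksAfter b xs

flagPeaks : List (Fin n) → List (Fin n × Bool)
flagPeaks []       = []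
flagPeaks (a ∷ xs) = (a , false) ∷ flagPeaksAfter a xs

peaks-flagPeaksAfter : (a : Fin n) (xs : List (Fin n)) → peaks (a ∷ xs) ≡ map proj₁ (filterᵇ proj₂ (flagPeaksAfter a xs))
peaks-flagPeaksAfter a [] = refl
peaks-flagPeaksAfter a (b ∷ []) = refl
peaks-flagPeaksAfter a (b ∷ c ∷ xs) with ⌊ a <? b ⌋ ∧ ⌊ c <? b ⌋ | peaks-flagPeaksAfter b (c ∷ xs)
... | true  | ih = cong (b ∷_) ih
... | false | ih = ih

peaks-flagPeaks : (xs : List (Fin n)) → peaks xs ≡ map proj₁ (filterᵇ proj₂ (flagPeaks xs))
peaks-flagPeaks []       = refl
peaks-flagPeaks (a ∷ xs) = peaks-flagPeaksAfter a xs

map-proj₁-flagPeaksAfter : (a : Fin n) (xs : List (Fin n)) → map proj₁ (flagPeaksAfter a xs) ≡ xs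
map-proj₁-flagPeaksAfter a []       = refl
map-proj₁-flagPeaksAfter a (b ∷ xs) = cong (b ∷_) (map-proj₁-flagPeaksAfter b xs)

map-proj₁-flagPeaks : (xs : List (Fin n)) → map proj₁ (flagPeaks xs) ≡ xs
map-proj₁-flagPeaks []       = refl
map-proj₁-flagPeaks (a ∷ xs) = cong (a ∷_) (map-proj₁-flagPeaksAfter a xs)

HeadBelow : Fin n → List (Fin n) → Set
HeadBelow b []      = ⊤
HeadBelow b (c ∷ _) = c <ᶠ b

peakFlag-before : ∀ {a b : Fin n} xs → peakFlag a b xs ≡ true → a <ᶠ b
peakFlag-before {a = a} {b} (c ∷ xs) flag with a <? b
... | yes a<b = a<b

peakFlag-after : ∀ {a b : Fin n} xs → peakFlag a b xs ≡ true → HeadBelow b xs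
peakFlag-after {a = a} {b} (c ∷ xs) flag with a <? b | c <? b
... | yes _ | yes c<b = c<b

isPeakUpTo isLowBelow : Fin n → Fin n × Bool → Bool
isPeakUpTo v (u , f) = f ∧ ⌊ u ≤? v ⌋
isLowBelow v (u , f) = not f ∧ ⌊ u <? v ⌋

mark : Fin n → Fin n × Bool → Mark
mark v (u , true) with u ≤? v
... | yes _ = peak
... | no _  = other
mark v (u , false) with u <? v
... | yes _ = low
... | no _  = other

isPeak-mark : (v : Fin n) (w : Fin n × Bool) → isPeak (mark v w) ≡ isPeakUpTo v w
isPeak-mark v (u , true) with u ≤? v
... | yes _ = refl
... | no _  = refl
isPeak-mark v (u , false) with u <? v
... | yes _ = refl
... | no _  = refl

isLow-mark : (v : Fin n) (w : Fin n × Bool) → isLow (mark v w) ≡ isLowBelow v w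
isLow-mark v (u , true) with u ≤? v
... | yes _ = refl
... | no _  = refl
isLow-mark v (u , false) with u <? v
... | yes _ = refl
... | no _  = refl

mark≡peak : ∀ (v u : Fin n) f → mark v (u , f) ≡ peak → f ≡ true × u ≤ᶠ v
mark≡peak v u true m≡peak with u ≤? v
... | yes u≤v = refl , u≤v
mark≡peak v u false m≡peak with u <? v
mark≡peak v u false () | yes _
mark≡peak v u false () | no _

mark-low : ∀ {v u : Fin n} → u <ᶠ v → mark v (u , false) ≡ low
mark-low {v = v} {u} u<v with u <? v
... | yes _  = refl
... | no u≮v = contradiction u<v u≮v

mark-self : (v : Fin n) → mark v (v , true) ≡ peak
mark-self v with v ≤? v
... | yes _  = refl
... | no v≰v = contradiction Fin.≤-refl v≰v

-- Both neighbours of a peak b ≤ v are smaller than b, so they are below v and not peaks.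
flanked-after : (v a : Fin n) (f : Bool) (xs : List (Fin n)) → (f ≡ true → HeadBelow a xs) →
                Flanked (mark v (a , f)) (map (mark v) (flagPeaksAfter a xs))
flanked-after v a f [] _ = tt
flanked-after v a f (b ∷ xs) a-flag = flank , flanked-after v b (peakFlag a b xs) xs (peakFlag-after xs)
  where
  flank : mark v (b , peakFlag a b xs) ≡ peak → mark v (a , f) ≡ low × head (map (mark v) (flagPeaksAfter b xs)) ≡ just low
  flank m≡peak = a-low f a-flag , next-low xs b-peak
    where
    b-peak = proj₁ (mark≡peak v b (peakFlag a b xs) m≡peak)
    b≤v    = proj₂ (mark≡peak v b (peakFlag a b xs) m≡peak)
    a<b    = peakFlag-before xs b-peak
    a-low : ∀ f → (f ≡ true → HeadBelow a (b ∷ xs)) → mark v (a , f) ≡ low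
    a-low true  a-flag = contradiction (a-flag refl) (Fin.<-asym a<b)
    a-low false _      = mark-low (ℕ.<-≤-trans a<b b≤v)
    next-low : ∀ xs → peakFlag a b xs ≡ true → head (map (mark v) (flagPeaksAfter b xs)) ≡ just low
    next-low (c ∷ ys) flag with peakFlag b c ys in c-flag
    ... | true  = contradiction (peakFlag-before ys c-flag) (Fin.<-asym (peakFlag-after (c ∷ ys) flag))
    ... | false = cong just (mark-low (ℕ.<-≤-trans (peakFlag-after (c ∷ ys) flag) b≤v))

peakPositions<lowPositions : (v : Fin n) (xs : List (Fin n)) → v ∈ peaks xs →
  count (isPeakUpTo v) (flagPeaks xs) < count (isLowBelow v) (flagPeaks xs)
peakPositions<lowPositions {n} v (a ∷ ys) v∈peaks = begin-strict
  count (isPeakUpTo v) (flagPeaksAfter a ys)          ≡⟨ sym (count-marks isPeak isPeakUpTo (isPeak-mark v) (flagPeaksAfter a ys)) ⟩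
  count isPeak (map (mark v) (flagPeaksAfter a ys))   <⟨ count-peak<count-low _ (flanked-after v a false ys λ ()) peak∈marks ⟩
  count isLow (map (mark v) (flagPeaks (a ∷ ys)))     ≡⟨ count-marks isLow isLowBelow (isLow-mark v) (flagPeaks (a ∷ ys)) ⟩
  count (isLowBelow v) (flagPeaks (a ∷ ys))           ∎
  where
  open ℕ.≤-Reasoning
  count-marks : (p : Mark → Bool) (q : Fin n → Fin n × Bool → Bool) → (∀ w → p (mark v w) ≡ q v w) →
                ∀ ws → count p (map (mark v) ws) ≡ count (q v) ws
  count-marks p q p∘mark≗q ws = trans (count-map p (mark v) ws) (count-cong p∘mark≗q ws)
  peak∈marks : peak ∈ map (mark v) (flagPeaksAfter a ys)
  peak∈marks with ∈-map⁻ proj₁ (subst (v ∈_) (peaks-flagPeaksAfter a ys) v∈peaks)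
  ... | (v , f) , w∈ , refl with ∈-filter⁻ (T? ∘ proj₂) {xs = flagPeaksAfter a ys} w∈
  peak∈marks | (v , true) , _ , refl | w∈flags , _ =
    subst (_∈ map (mark v) (flagPeaksAfter a ys)) (mark-self v) (∈-map⁺ (mark v) w∈flags)

count-peaks : (p : Fin n → Bool) (xs : List (Fin n)) → count p (peaks xs) ≡ count (λ w → proj₂ w ∧ p (proj₁ w)) (flagPeaks xs)
count-peaks p xs = begin
  count p (peaks xs)                                     ≡⟨ cong (count p) (peaks-flagPeaks xs) ⟩
  count p (map proj₁ (filterᵇ proj₂ (flagPeaks xs)))     ≡⟨ count-map p proj₁ (filterᵇ proj₂ (flagPeaks xs)) ⟩
  count (p ∘ proj₁) (filterᵇ proj₂ (flagPeaks xs))       ≡⟨ count-filterᵇ (p ∘ proj₁) proj₂ (flagPeaks xs) ⟩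
  count (λ w → proj₂ w ∧ p (proj₁ w)) (flagPeaks xs)     ∎
  where open ≡-Reasoning

peaksBelow<peaksUpTo : (v : Fin n) (xs : List (Fin n)) → v ∈ peaks xs →
  suc (count (λ u → ⌊ u ∈? peaks xs ⌋ ∧ ⌊ u <? v ⌋) (allFin n)) ≤ count (λ u → ⌊ u ≤? v ⌋) (peaks xs)
peaksBelow<peaksUpTo {n} v xs v∈peaks =
  subst₂ _≤_ (cong suc (length-filterᵇ peak-below-v (allFin n))) (length-filterᵇ upTo-v (peaks xs))
    (Unique⇒length≤ (All.tabulate v≢ ∷ Unique.filter⁺ (T? ∘ peak-below-v) (Unique.allFin⁺ n)) ⊆-upTo-v)
  where
  peak-below-v upTo-v : Fin n → Bool
  peak-below-v u = ⌊ u ∈? peaks xs ⌋ ∧ ⌊ u <? v ⌋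
  upTo-v u = ⌊ u ≤? v ⌋
  peak-below : ∀ {u} → u ∈ filterᵇ peak-below-v (allFin n) → u ∈ peaks xs × u <ᶠ v
  peak-below {u} u∈ with Equivalence.to (T-∧ {⌊ u ∈? peaks xs ⌋} {⌊ u <? v ⌋}) (Equivalence.to ∈-filterᵇ-allFin u∈)
  ... | u∈peaks , u<v = toWitness {a? = u ∈? peaks xs} u∈peaks , toWitness {a? = u <? v} u<v
  v≢ : ∀ {u} → u ∈ filterᵇ peak-below-v (allFin n) → v ≢ u
  v≢ u∈ refl = ℕ.<-irrefl refl (proj₂ (peak-below u∈))
  ⊆-upTo-v : ∀ {u} → u ∈ v ∷ filterᵇ peak-below-v (allFin n) → u ∈ filterᵇ upTo-v (peaks xs)
  ⊆-upTo-v (here refl) = ∈-filter⁺ (T? ∘ upTo-v) v∈peaks (fromWitness {a? = v ≤? v} Fin.≤-refl)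
  ⊆-upTo-v {u} (there u∈) =
    ∈-filter⁺ (T? ∘ upTo-v) (proj₁ (peak-below u∈)) (fromWitness {a? = u ≤? v} (ℕ.<⇒≤ (proj₂ (peak-below u∈))))

lowPositions≤nonPeaksBelow : (v : Fin n) (xs : List (Fin n)) → Unique xs →
  count (isLowBelow v) (flagPeaks xs) ≤ count (λ u → not ⌊ u ∈? peaks xs ⌋ ∧ ⌊ u <? v ⌋) (allFin n)
lowPositions≤nonPeaksBelow {n} v xs unique =
  subst₂ _≤_ (trans (List.length-map proj₁ lows) (length-filterᵇ (isLowBelow v) W))
    (length-filterᵇ nonpeak-below-v (allFin n)) (Unique⇒length≤ unique-lows lows⊆)
  where
  W    = flagPeaks xs
  lows = filterᵇ (isLowBelow v) W
  nonpeak-below-v : Fin n → Bool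
  nonpeak-below-v u = not ⌊ u ∈? peaks xs ⌋ ∧ ⌊ u <? v ⌋
  unique-W : Unique (map proj₁ W)
  unique-W = subst Unique (sym (map-proj₁-flagPeaks xs)) unique
  unique-lows : Unique (map proj₁ lows)
  unique-lows = AllPairs.map⁺ (AllPairs.filter⁺ (T? ∘ isLowBelow v) (AllPairs.map⁻ unique-W))
  clash : ∀ {b} → T (not b) → ¬ T b
  clash {false} _ ()
  lows⊆ : ∀ {u} → u ∈ map proj₁ lows → u ∈ filterᵇ nonpeak-below-v (allFin n)
  lows⊆ u∈ with ∈-map⁻ proj₁ u∈
  ... | (u , f) , w∈lows , refl with ∈-filter⁻ (T? ∘ isLowBelow v) {xs = W} w∈lows
  ... | w∈W , is-low with Equivalence.to (T-∧ {not f} {⌊ u <? v ⌋}) is-low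
  ... | not-f , u<v =
    Equivalence.from ∈-filterᵇ-allFin (Equivalence.from T-∧ (fromWitnessFalse {a? = u ∈? peaks xs} u∉peaks , u<v))
    where
    u∉peaks : ¬ u ∈ peaks xs
    u∉peaks u∈peaks with ∈-map⁻ proj₁ (subst (u ∈_) (peaks-flagPeaks xs) u∈peaks)
    ... | (u , f′) , w′∈ , refl with ∈-filter⁻ (T? ∘ proj₂) {xs = W} w′∈
    ... | w′∈W , f′-true with Unique-map-injective unique-W w∈W w′∈W refl
    ... | refl = clash not-f f′-true

CP-balanced : (σ : Vec (Fin n) n) → Unique (toList σ) → Balanced 0 (CP σ)
CP-balanced {n} σ unique {v} v∈CP = begin
  below (CP σ) v + 2                                            ≡⟨ ℕ.+-comm (below (CP σ) v) 2 ⟩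
  suc (suc (below (CP σ) v))                                    ≡⟨ cong (2 +_) (count-cong in-CP (allFin n)) ⟩
  suc (suc (count (λ u → ⌊ u ∈? Pk ⌋ ∧ ⌊ u <? v ⌋) (allFin n)))  ≤⟨ s≤s (peaksBelow<peaksUpTo v L v∈Pk) ⟩
  suc (count (λ u → ⌊ u ≤? v ⌋) Pk)                             ≡⟨ cong suc (count-peaks (λ u → ⌊ u ≤? v ⌋) L) ⟩
  suc (count (isPeakUpTo v) (flagPeaks L))                       ≤⟨ peakPositions<lowPositions v L v∈Pk ⟩
  count (isLowBelow v) (flagPeaks L)                            ≤⟨ lowPositions≤nonPeaksBelow v L unique ⟩
  count (λ u → not ⌊ u ∈? Pk ⌋ ∧ ⌊ u <? v ⌋) (allFin n)         ≡⟨ sym (count-cong in-∁CP (allFin n)) ⟩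
  below (∁ (CP σ)) v                                            ∎
  where
  open ℕ.≤-Reasoning
  L  = toList σ
  Pk = peaks L
  v∈Pk : v ∈ Pk
  v∈Pk = toWitness {a? = v ∈? Pk} (Equivalence.from T-≡ (trans (sym (lookup-CP σ v)) ([]=⇒lookup v∈CP)))
  in-CP : ∀ u → lookup (CP σ) u ∧ does (u <? v) ≡ ⌊ u ∈? Pk ⌋ ∧ ⌊ u <? v ⌋
  in-CP u = cong₂ _∧_ (lookup-CP σ u) (sym (isYes≗does (u <? v)))
  in-∁CP : ∀ u → lookup (∁ (CP σ)) u ∧ does (u <? v) ≡ not ⌊ u ∈? Pk ⌋ ∧ ⌊ u <? v ⌋
  in-∁CP u = cong₂ _∧_ (trans (lookup-map u not (CP σ)) (cong not (lookup-CP σ u))) (sym (isYes≗does (u <? v)))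

peakSet⇔admissible : (n : ℕ) (S : Subset n) → Any (λ σ → CP σ ≡ S) (perms n) ⇔ T (admissible 0 S)
peakSet⇔admissible n S = mk⇔ peakSet⇒admissible (balanced⇒peakSet S ∘ admissible⇒balanced 0 S)
  where
  peakSet⇒admissible : Any (λ σ → CP σ ≡ S) (perms n) → T (admissible 0 S)
  peakSet⇒admissible realised with find realised
  ... | σ , σ∈perms , refl = balanced⇒admissible 0 (CP σ) (CP-balanced σ
          (proj₂ (∈-filter⁻ (λ σ → DecUnique.unique? _≟ᶠ_ (toList σ)) {xs = vecsOver (allFin n) n} σ∈perms)))

admissibleOfSize : ℕ → ℕ → Subset m → Bool
admissibleOfSize c j S = does (∣ S ∣ ℕ.≟ j) ∧ admissible c S

admissibleCount : ℕ → ℕ → ℕ → ℕ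
admissibleCount c m j = count (admissibleOfSize c j) (subsets m)

pp≡admissibleCount : ∀ n j → pp n j ≡ admissibleCount 0 n j
pp≡admissibleCount n j = length-filter≡count (λ S → (∣ S ∣ ℕ.≟ j) ×-dec inP? n S) (admissibleOfSize 0 j)
  (λ S → cong (does (∣ S ∣ ℕ.≟ j) ∧_) (does-⇔ (peakSet⇔admissible n S) (inP? n S) (T? (admissible 0 S))))
  (subsets n)

count-subsets-cons : (p : Subset (suc m) → Bool) →
  count p (subsets (suc m)) ≡ count (λ S → p (inside ∷ S)) (subsets m) + count (λ S → p (outside ∷ S)) (subsets m)
count-subsets-cons {m} p = begin
  count p (map (inside ∷_) (subsets m) ++ map (outside ∷_) (subsets m) ++ [])
    ≡⟨ count-++ p (map (inside ∷_) (subsets m)) (map (outside ∷_) (subsets m) ++ []) ⟩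
  count p (map (inside ∷_) (subsets m)) + count p (map (outside ∷_) (subsets m) ++ [])
    ≡⟨ cong₂ _+_ (count-map p (inside ∷_) (subsets m))
                 (trans (cong (count p) (List.++-identityʳ (map (outside ∷_) (subsets m)))) (count-map p (outside ∷_) (subsets m))) ⟩
  count (λ S → p (inside ∷ S)) (subsets m) + count (λ S → p (outside ∷ S)) (subsets m) ∎
  where open ≡-Reasoning

-- `subsets` is enumerated by prepending the smallest value; this reads it as appending the largest.
count-subsets-∷ʳ : (p : Subset (suc m) → Bool) →
  count p (subsets (suc m)) ≡ count (λ S → p (S ∷ʳ inside)) (subsets m) + count (λ S → p (S ∷ʳ outside)) (subsets m)
count-subsets-∷ʳ {zero} p = trans (count-subsets-cons p) (cong₂ _+_ (cons≗snoc inside) (cons≗snoc outside))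
  where
  cons≗snoc : ∀ x → count (λ S → p (x ∷ S)) (subsets 0) ≡ count (λ S → p (S ∷ʳ x)) (subsets 0)
  cons≗snoc x = count-cong {p = λ S → p (x ∷ S)} {q = λ S → p (S ∷ʳ x)} (λ { [] → refl }) (subsets 0)
count-subsets-∷ʳ {suc m} p = begin
  count p (subsets (suc (suc m)))
    ≡⟨ count-subsets-cons p ⟩
  count (λ S → p (inside ∷ S)) (subsets (suc m)) + count (λ S → p (outside ∷ S)) (subsets (suc m))
    ≡⟨ cong₂ _+_ (count-subsets-∷ʳ (λ S → p (inside ∷ S))) (count-subsets-∷ʳ (λ S → p (outside ∷ S))) ⟩
  (c inside inside + c inside outside) + (c outside inside + c outside outside)
    ≡⟨ interchange (c inside inside) _ _ _ ⟩
  (c inside inside + c outside inside) + (c inside outside + c outside outside)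
    ≡⟨ sym (cong₂ _+_ (count-subsets-cons (λ S → p (S ∷ʳ inside))) (count-subsets-cons (λ S → p (S ∷ʳ outside)))) ⟩
  count (λ S → p (S ∷ʳ inside)) (subsets (suc m)) + count (λ S → p (S ∷ʳ outside)) (subsets (suc m)) ∎
  where
  open ≡-Reasoning
  c : Bool → Bool → ℕ
  c x y = count (λ S → p (x ∷ (S ∷ʳ y))) (subsets m)

∣S∷ʳinside∣ : (S : Subset m) → ∣ S ∷ʳ inside ∣ ≡ suc ∣ S ∣
∣S∷ʳinside∣ []            = refl
∣S∷ʳinside∣ (inside ∷ S)  = cong suc (∣S∷ʳinside∣ S)
∣S∷ʳinside∣ (outside ∷ S) = ∣S∷ʳinside∣ S

∣S∷ʳoutside∣ : (S : Subset m) → ∣ S ∷ʳ outside ∣ ≡ ∣ S ∣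
∣S∷ʳoutside∣ []            = refl
∣S∷ʳoutside∣ (inside ∷ S)  = cong suc (∣S∷ʳoutside∣ S)
∣S∷ʳoutside∣ (outside ∷ S) = ∣S∷ʳoutside∣ S

admissibleOfSize-∷ʳ-outside : ∀ c j (S : Subset m) → admissibleOfSize c j (S ∷ʳ outside) ≡ admissibleOfSize c j S
admissibleOfSize-∷ʳ-outside c j S = cong₂ (λ k b → does (k ℕ.≟ j) ∧ b) (∣S∷ʳoutside∣ S) (admissible-∷ʳ-outside c S)

admissibleOfSize-∷ʳ-inside : ∀ c j (S : Subset m) →
  admissibleOfSize c (suc j) (S ∷ʳ inside) ≡ admissibleOfSize c j S ∧ does (2 * suc j ℕ.≤? c + m)
admissibleOfSize-∷ʳ-inside {m} c j S rewrite ∣S∷ʳinside∣ S with ∣ S ∣ ℕ.≟ j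
... | yes ∣S∣≡j = begin
  does (∣ S ∣ ℕ.≟ j) ∧ admissible c (S ∷ʳ inside)   ≡⟨ cong (_∧ admissible c (S ∷ʳ inside)) (dec-true (∣ S ∣ ℕ.≟ j) ∣S∣≡j) ⟩
  admissible c (S ∷ʳ inside)                       ≡⟨ admissible-∷ʳ-inside c S ⟩
  admissible c S ∧ does (2 * suc ∣ S ∣ ℕ.≤? c + m)   ≡⟨ cong₂ (λ b k → (b ∧ admissible c S) ∧ does (2 * suc k ℕ.≤? c + m))
                                                             (sym (dec-true (∣ S ∣ ℕ.≟ j) ∣S∣≡j)) ∣S∣≡j ⟩
  (does (∣ S ∣ ℕ.≟ j) ∧ admissible c S) ∧ does (2 * suc j ℕ.≤? c + m) ∎
  where open ≡-Reasoning
... | no ∣S∣≢j rewrite dec-false (∣ S ∣ ℕ.≟ j) ∣S∣≢j = refl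

admissibleOfSize-∷ʳ-inside-0 : ∀ c (S : Subset m) → admissibleOfSize c 0 (S ∷ʳ inside) ≡ false
admissibleOfSize-∷ʳ-inside-0 c S rewrite ∣S∷ʳinside∣ S = refl

admissibleCount-suc-size : ∀ c m j → admissibleCount c (suc m) (suc j) ≡
  (if does (2 * suc j ℕ.≤? c + m) then admissibleCount c m j else 0) + admissibleCount c m (suc j)
admissibleCount-suc-size c m j = begin
  admissibleCount c (suc m) (suc j)
    ≡⟨ count-subsets-∷ʳ {m} (admissibleOfSize c (suc j)) ⟩
  count (λ S → admissibleOfSize c (suc j) (S ∷ʳ inside)) (subsets m)
    + count (λ S → admissibleOfSize c (suc j) (S ∷ʳ outside)) (subsets m)
    ≡⟨ cong₂ _+_ (count-cong (admissibleOfSize-∷ʳ-inside c j) (subsets m))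
                 (count-cong (admissibleOfSize-∷ʳ-outside c (suc j)) (subsets m)) ⟩
  count (λ S → admissibleOfSize c j S ∧ fits) (subsets m) + admissibleCount c m (suc j)
    ≡⟨ cong (_+ admissibleCount c m (suc j)) (count-∧-const (admissibleOfSize c j) fits (subsets m)) ⟩
  (if fits then admissibleCount c m j else 0) + admissibleCount c m (suc j) ∎
  where
  open ≡-Reasoning
  fits : Bool
  fits = does (2 * suc j ℕ.≤? c + m)

admissibleCount-suc-empty : ∀ c m → admissibleCount c (suc m) 0 ≡ admissibleCount c m 0
admissibleCount-suc-empty c m = begin
  admissibleCount c (suc m) 0
    ≡⟨ count-subsets-∷ʳ {m} (admissibleOfSize c 0) ⟩
  count (λ S → admissibleOfSize c 0 (S ∷ʳ inside)) (subsets m)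
    + count (λ S → admissibleOfSize c 0 (S ∷ʳ outside)) (subsets m)
    ≡⟨ cong₂ _+_ (trans (count-cong (admissibleOfSize-∷ʳ-inside-0 c) (subsets m)) (count-false (subsets m)))
                 (count-cong (admissibleOfSize-∷ʳ-outside c 0) (subsets m)) ⟩
  admissibleCount c m 0 ∎
  where open ≡-Reasoning

admissibleCount-vanishes : ∀ c m j → c + m ≤ 2 * suc j → admissibleCount c m (suc j) ≡ 0
admissibleCount-vanishes c zero j _ = refl
admissibleCount-vanishes c (suc m) j c+m+1≤2[1+j] = begin
  admissibleCount c (suc m) (suc j)
    ≡⟨ admissibleCount-suc-size c m j ⟩
  (if does (2 * suc j ℕ.≤? c + m) then admissibleCount c m j else 0) + admissibleCount c m (suc j)
    ≡⟨ cong₂ (λ b k → (if b then admissibleCount c m j else 0) + k)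
             (dec-false (2 * suc j ℕ.≤? c + m) (ℕ.<⇒≱ c+m<2[1+j])) (admissibleCount-vanishes c m j (ℕ.<⇒≤ c+m<2[1+j])) ⟩
  0 ∎
  where
  open ≡-Reasoning
  c+m<2[1+j] : c + m < 2 * suc j
  c+m<2[1+j] = ℕ.<-≤-trans (ℕ.+-monoʳ-< c (ℕ.n<1+n m)) c+m+1≤2[1+j]

pp-suc-empty : ∀ n → pp (n + 1) 0 ≡ pp n 0
pp-suc-empty n = begin
  pp (n + 1) 0                 ≡⟨ cong (λ k → pp k 0) (ℕ.+-comm n 1) ⟩
  pp (suc n) 0                 ≡⟨ pp≡admissibleCount (suc n) 0 ⟩
  admissibleCount 0 (suc n) 0  ≡⟨ admissibleCount-suc-empty 0 n ⟩
  admissibleCount 0 n 0        ≡⟨ sym (pp≡admissibleCount n 0) ⟩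
  pp n 0                       ∎
  where open ≡-Reasoning

pp-suc : ∀ n j → pp (n + 1) (suc j) ≡ (if does (2 * suc j ℕ.≤? n) then pp n j else 0) + pp n (suc j)
pp-suc n j = begin
  pp (n + 1) (suc j)
    ≡⟨ cong (λ k → pp k (suc j)) (ℕ.+-comm n 1) ⟩
  pp (suc n) (suc j)
    ≡⟨ pp≡admissibleCount (suc n) (suc j) ⟩
  admissibleCount 0 (suc n) (suc j)
    ≡⟨ admissibleCount-suc-size 0 n j ⟩
  (if does (2 * suc j ℕ.≤? n) then admissibleCount 0 n j else 0) + admissibleCount 0 n (suc j)
    ≡⟨ sym (cong₂ (λ a b → (if does (2 * suc j ℕ.≤? n) then a else 0) + b) (pp≡admissibleCount n j) (pp≡admissibleCount n (suc j))) ⟩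
  (if does (2 * suc j ℕ.≤? n) then pp n j else 0) + pp n (suc j) ∎
  where open ≡-Reasoning

pp-suc-room : ∀ n j → 2 * suc j ≤ n → pp (n + 1) (suc j) ≡ pp n j + pp n (suc j)
pp-suc-room n j room rewrite pp-suc n j | dec-true (2 * suc j ℕ.≤? n) room = refl

pp-suc-top : ∀ n j → n ≡ 2 * suc j → pp (n + 1) (suc j) ≡ pp n j
pp-suc-top n j n≡2[1+j] = begin
  pp (n + 1) (suc j)       ≡⟨ pp-suc-room n j (ℕ.≤-reflexive (sym n≡2[1+j])) ⟩
  pp n j + pp n (suc j)    ≡⟨ cong (pp n j +_) (trans (pp≡admissibleCount n (suc j)) (admissibleCount-vanishes 0 n j (ℕ.≤-reflexive n≡2[1+j]))) ⟩
  pp n j + 0               ≡⟨ ℕ.+-identityʳ (pp n j) ⟩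
  pp n j                   ∎
  where open ≡-Reasoning

≤/2⇒2*≤ : ∀ j x → j ≤ x / 2 → 2 * j ≤ x
≤/2⇒2*≤ j x j≤x/2 = ℕ.≤-trans (ℕ.≤-reflexive (ℕ.*-comm 2 j)) (ℕ.≤-trans (ℕ.*-monoˡ-≤ 2 j≤x/2) (m/n*n≤m x 2))

even⇒≡2*/2 : ∀ n → n % 2 ≡ 0 → n ≡ 2 * (n / 2)
even⇒≡2*/2 n n%2≡0 = trans (m≡m%n+[m/n]*n n 2) (trans (cong (_+ n / 2 * 2) n%2≡0) (ℕ.*-comm (n / 2) 2))

corollary3p3 : ((n : ℕ) → 3 ≤ n →
    (n % 2 ≡ 0 →
      (pp (n + 1) 0 ≡ pp n 0)
      × ((j : ℕ) → 1 ≤ j → j ≤ n / 2 ∸ 1 → pp (n + 1) j ≡ pp n (j ∸ 1) + pp n j)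
      × (pp (n + 1) (n / 2) ≡ pp n (n / 2 ∸ 1)))
    × (n % 2 ≡ 1 →
      (pp (n + 1) 0 ≡ pp n 0)
      × ((j : ℕ) → 1 ≤ j → j ≤ (n ∸ 1) / 2 → pp (n + 1) j ≡ pp n (j ∸ 1) + pp n j)))
  × (pp 3 0 ≡ 1) × (pp 3 1 ≡ 1)
corollary3p3 = (λ n 3≤n → even n 3≤n , λ _ → pp-suc-empty n , odd-middle n) , refl , refl
  where
  even : ∀ n → 3 ≤ n → n % 2 ≡ 0 → _
  even n 3≤n n%2≡0 = pp-suc-empty n , middle , top (n / 2) (even⇒≡2*/2 n n%2≡0)
    where
    middle : (j : ℕ) → 1 ≤ j → j ≤ n / 2 ∸ 1 → pp (n + 1) j ≡ pp n (j ∸ 1) + pp n j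
    middle (suc j) _ j<n/2 = pp-suc-room n j (≤/2⇒2*≤ (suc j) n (ℕ.≤-trans j<n/2 (ℕ.m∸n≤m (n / 2) 1)))
    top : ∀ h → n ≡ 2 * h → pp (n + 1) h ≡ pp n (h ∸ 1)
    top zero    n≡0      = contradiction (subst (3 ≤_) n≡0 3≤n) λ ()
    top (suc h) n≡2[1+h] = pp-suc-top n h n≡2[1+h]
  odd-middle : ∀ n (j : ℕ) → 1 ≤ j → j ≤ (n ∸ 1) / 2 → pp (n + 1) j ≡ pp n (j ∸ 1) + pp n j
  odd-middle n (suc j) _ j≤[n-1]/2 = pp-suc-room n j (ℕ.≤-trans (≤/2⇒2*≤ (suc j) (n ∸ 1) j≤[n-1]/2) (ℕ.m∸n≤m n 1))
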